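{- Let $G$ be a connected graph of order $n \ge 4$. Then $\mathrm{sroy}(G\,\Box\,K_2) \le \mathrm{sroy}(G)+1$. Consequently, if $G$ is a royal-zero graph, then $G\,\Box\,K_2$ is a royal-zero graph.
   Context: For a positive integer $k$, let $[k]=\{1,\dots,k\}$ and let $\mathcal{P}^*([k])$ denote the set of the $2^k-1$ nonempty subsets of $[k]$. For a connected graph $G$ of order at least $3$, an edge coloring $c:E(G)\to\mathcal{P}^*([k])$ induces the vertex coloring $c'(v)=\bigcup_{e\in E_v}c(e)$, where $E_v$ is the set of edges incident with $v$. The coloring $c$ is a strong royal $k$-edge coloring if $c'$ is injective on $V(G)$. The strong royal index $\mathrm{sroy}(G)$ is the minimum $k$ for which $G$ has a strong royal $k$-edge coloring. A connected graph $G$ of order $n\ge 3$, where $k$ is the unique integer with $2^{k-1}\le n\le 2^k-1$, is royal-zero if $\mathrm{sroy}(G)=k$. $G\,\Box\,K_2$ denotes the Cartesian product of $G$ with $K_2$. -}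

module Defs where

open import Data.Nat using (ℕ; zero; suc; _+_; _∸_; _^_; _≤_; _<_)
open import Data.Bool using (Bool; true; false; T; if_then_else_)
open import Data.Fin using (Fin; splitAt; _≟_)
open import Data.Fin.Subset using (Subset; _∪_; ⊥; Nonempty)
open import Data.List using (foldr; allFin)
open import Data.Sum using (_⊎_; inj₁; inj₂)
open import Data.Product using (Σ; _×_; ∃-syntax)
open import Relation.Nullary.Decidable using (⌊_⌋)
open import Relation.Binary.PropositionalEquality using (_≡_; refl)
open import Function.Definitions using (Injective)
open import Relation.Nullary using (yes; no)
open import Data.Empty using (⊥-elim)

record Graph (n : ℕ) : Set where
  field
    Adj    : Fin n → Fin n → Bool
    sym    : ∀ u v → Adj u v ≡ Adj v u
    irrefl : ∀ v → Adj v v ≡ false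
open Graph public

data Walk {n : ℕ} (G : Graph n) : Fin n → Fin n → Set where
  here : ∀ {v} → Walk G v v
  step : ∀ {u w v} → T (Adj G u w) → Walk G w v → Walk G u v

Connected : ∀ {n} → Graph n → Set
Connected {n} G = ∀ (u v : Fin n) → Walk G u v

-- The colour of the edge uv is c u v; c must be
-- symmetric and nonempty on edges; its values on non-edges are irrelevant.
record EdgeColouring {n : ℕ} (G : Graph n) (k : ℕ) : Set where
  field
    col      : Fin n → Fin n → Subset k
    col-sym  : ∀ u v → T (Adj G u v) → col u v ≡ col v u
    col-nonempty : ∀ u v → T (Adj G u v) → Nonempty (col u v)
open EdgeColouring public

induced : ∀ {n k} {G : Graph n} → EdgeColouring G k → Fin n → Subset k
induced {n} {k} {G} c v =
  foldr (λ u acc → (if Adj G v u then col c v u else ⊥) ∪ acc) ⊥ (allFin n)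

IsStrongRoyal : ∀ {n k} {G : Graph n} → EdgeColouring G k → Set
IsStrongRoyal c = Injective _≡_ _≡_ (induced c)

HasStrongRoyal : ∀ {n} → Graph n → ℕ → Set
HasStrongRoyal G k = Σ (EdgeColouring G k) IsStrongRoyal

IsSroy : ∀ {n} → Graph n → ℕ → Set
IsSroy G k = HasStrongRoyal G k × (∀ j → HasStrongRoyal G j → k ≤ j)

RoyalZero : ∀ {n} → Graph n → Set
RoyalZero {n} G =
  Connected G × 3 ≤ n ×
  (∃[ k ] (2 ^ (k ∸ 1) ≤ n × n < 2 ^ k × IsSroy G k))

-- Cartesian product G □ K₂ on Fin (n + n): vertex (v , i) is the image of
-- v in the i-th copy (via splitAt).
□K₂-adj : ∀ {n} → Graph n → Fin n ⊎ Fin n → Fin n ⊎ Fin n → Bool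
□K₂-adj G (inj₁ a) (inj₁ b) = Adj G a b
□K₂-adj G (inj₂ a) (inj₂ b) = Adj G a b
□K₂-adj G (inj₁ a) (inj₂ b) = ⌊ a ≟ b ⌋
□K₂-adj G (inj₂ a) (inj₁ b) = ⌊ a ≟ b ⌋

private
  ≟-sym : ∀ {n} (a b : Fin n) → ⌊ a ≟ b ⌋ ≡ ⌊ b ≟ a ⌋
  ≟-sym a b with a ≟ b | b ≟ a
  ... | yes _ | yes _ = refl
  ... | no _  | no _  = refl
  ... | yes refl | no q = ⊥-elim (q refl)
  ... | no q | yes refl = ⊥-elim (q refl)

  adj-sym : ∀ {n} (G : Graph n) x y → □K₂-adj G x y ≡ □K₂-adj G y x
  adj-sym G (inj₁ a) (inj₁ b) = sym G a b
  adj-sym G (inj₂ a) (inj₂ b) = sym G a b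
  adj-sym G (inj₁ a) (inj₂ b) = ≟-sym a b
  adj-sym G (inj₂ a) (inj₁ b) = ≟-sym a b

  adj-irr : ∀ {n} (G : Graph n) x → □K₂-adj G x x ≡ false
  adj-irr G (inj₁ a) = irrefl G a
  adj-irr G (inj₂ a) = irrefl G a

_□K₂ : ∀ {n} → Graph n → Graph (n + n)
_□K₂ {n} G = record
  { Adj    = λ x y → □K₂-adj G (splitAt n x) (splitAt n y)
  ; sym    = λ x y → adj-sym G (splitAt n x) (splitAt n y)
  ; irrefl = λ x → adj-irr G (splitAt n x)
  }

module Submission where

-- Let c be a strong royal k-edge colouring of G, with induced
-- vertex colouring c'.  Colour G □ K₂ with k + 1 colours, the new colour being
-- 0 and an old colour i becoming i + 1 (a subset of [k+1] is b ∷ s, where the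
-- bit b says whether 0 is present and s ⊆ [k] is the rest):
--   an edge ab of the first copy of G   gets  false ∷ c(ab),
--   an edge ab of the second copy of G  gets  true  ∷ c(ab),
--   a rung joining the two copies of a  gets  false ∷ c'(a).
-- Since a connected graph with ≥ 2 vertices has no isolated vertex, the induced
-- colour of the copy of a in layer b is exactly b ∷ c'(a) (lemma induced-□),
-- which is injective because c' is.
--
-- For the second claim, if 2^(k-1) ≤ n < 2^k then 2^k ≤ 2n < 2^(k+1); the
-- construction gives a strong royal (k+1)-colouring of G □ K₂, and the
-- counting bound (a graph without isolated vertices and with a strong royal
-- j-colouring has fewer than 2^j vertices, since its vertex colours are
-- distinct nonempty subsets of [j]) shows that no fewer colours suffice.

open import Defs hiding (sym)
open import Data.Nat using (ℕ; suc; _≤_)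
open import Data.Product using (_×_)

open import Data.Nat using (zero; _+_; _^_; _<_; s≤s; _<?_)
open import Data.Nat.Properties
  using (≤-trans; ≤-<-trans; m≤m+n; +-mono-≤; +-mono-<; +-identityʳ; ^-monoʳ-≤; ≮⇒≥; <⇒≱)
open import Data.Bool using (Bool; true; false; T; if_then_else_)
open import Data.Fin using (Fin; splitAt; join; funToFin; finToFun)
open import Data.Fin.Properties
  using (2↔Bool; finToFun-funToFin; splitAt-join; join-splitAt; injective⇒≤)
open import Data.Fin.Subset using (Subset; _∪_; ⊥; Nonempty; _∈_; _⊆_)
open import Data.Fin.Subset.Properties using (x∈p∪q⁻; x∈p∪q⁺; ∉⊥; ⊆-antisym; s⊆s)
open import Data.Vec using (_∷_; lookup; tabulate; here; there)
open import Data.Vec.Properties using (tabulate∘lookup; tabulate-cong; ∷-injective)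
open import Data.List using (List; []; foldr; allFin) renaming (_∷_ to _∷ₗ_)
open import Data.List.Membership.Propositional using () renaming (_∈_ to _∈ₗ_)
open import Data.List.Membership.Propositional.Properties using (∈-allFin)
open import Data.List.Relation.Unary.Any using () renaming (here to hereₗ; there to thereₗ)
open import Data.Sum using (_⊎_; inj₁; inj₂)
open import Data.Product using (_,_; proj₁; proj₂; ∃-syntax)
open import Relation.Nullary using (yes; no; contradiction)
open import Relation.Nullary.Decidable using (toWitness; fromWitness)
open import Relation.Binary.PropositionalEquality
  using (_≡_; _≢_; refl; sym; trans; cong; subst; subst₂; module ≡-Reasoning)
open import Function using (_∘_; Inverse)
open import Function.Definitions using (Injective)

NoIsolatedVertex : ∀ {n} → Graph n → Set
NoIsolatedVertex {n} G = ∀ (a : Fin n) → ∃[ b ] T (Adj G a b)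

-- Union of a family of subsets indexed by a list, in the shape used by `induced`.
⋃[_]_ : ∀ {A : Set} {k} → List A → (A → Subset k) → Subset k
⋃[ us ] f = foldr (λ u acc → f u ∪ acc) ⊥ us

∈-⋃⁻ : ∀ {A : Set} {k} (f : A → Subset k) (us : List A) {i} →
  i ∈ ⋃[ us ] f → ∃[ u ] i ∈ f u
∈-⋃⁻ f []        i∈ = contradiction i∈ ∉⊥
∈-⋃⁻ f (u ∷ₗ us) i∈ with x∈p∪q⁻ (f u) (⋃[ us ] f) i∈
... | inj₁ i∈fu = u , i∈fu
... | inj₂ i∈⋃  = ∈-⋃⁻ f us i∈⋃

∈-⋃⁺ : ∀ {A : Set} {k} (f : A → Subset k) (us : List A) {i u} →
  u ∈ₗ us → i ∈ f u → i ∈ ⋃[ us ] f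
∈-⋃⁺ f (u ∷ₗ us) (hereₗ refl) i∈ = x∈p∪q⁺ (inj₁ i∈)
∈-⋃⁺ f (u ∷ₗ us) (thereₗ u∈) i∈ = x∈p∪q⁺ (inj₂ (∈-⋃⁺ f us u∈ i∈))

module _ {n k} {G : Graph n} (c : EdgeColouring G k) where

  ∈-induced⁻ : ∀ v {i} → i ∈ induced c v → ∃[ u ] (T (Adj G v u) × i ∈ col c v u)
  ∈-induced⁻ v i∈ with ∈-⋃⁻ (λ u → if Adj G v u then col c v u else ⊥) (allFin n) i∈
  ... | u , i∈cvu = u , edge (Adj G v u) i∈cvu
    where
    edge : ∀ {i} (b : Bool) → i ∈ (if b then col c v u else ⊥) → T b × i ∈ col c v u
    edge true  i∈ = _ , i∈
    edge false i∈ = contradiction i∈ ∉⊥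

  ∈-induced⁺ : ∀ v u {i} → T (Adj G v u) → i ∈ col c v u → i ∈ induced c v
  ∈-induced⁺ v u {i} vu i∈ =
    ∈-⋃⁺ (λ u → if Adj G v u then col c v u else ⊥) (allFin n) (∈-allFin u) (edge (Adj G v u) vu)
    where
    edge : (b : Bool) → T b → i ∈ (if b then col c v u else ⊥)
    edge true _ = i∈

  induced-nonempty : ∀ v u → T (Adj G v u) → Nonempty (induced c v)
  induced-nonempty v u vu = let (i , i∈) = col-nonempty c v u vu in i , ∈-induced⁺ v u vu i∈

-- Binary encoding of subsets: the characteristic vector read as a number.
toBinary : ∀ {j} → Subset j → Fin (2 ^ j)
toBinary s = funToFin (Inverse.from 2↔Bool ∘ lookup s)

-- Distinct subsets have distinct encodings, as the digits recover the bits.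
toBinary-injective : ∀ {j} → Injective _≡_ _≡_ (toBinary {j})
toBinary-injective {j} {s} {t} eq = begin
  s                   ≡⟨ sym (tabulate∘lookup s) ⟩
  tabulate (lookup s) ≡⟨ tabulate-cong sameBit ⟩
  tabulate (lookup t) ≡⟨ tabulate∘lookup t ⟩
  t                   ∎
  where
  open ≡-Reasoning
  open Inverse 2↔Bool using (to; from; strictlyInverseˡ)
  digit : ∀ (u : Subset j) i → finToFun (toBinary u) i ≡ from (lookup u i)
  digit u = finToFun-funToFin (from ∘ lookup u)
  sameBit : ∀ i → lookup s i ≡ lookup t i
  sameBit i = begin
    lookup s i                    ≡⟨ sym (strictlyInverseˡ (lookup s i)) ⟩
    to (from (lookup s i))        ≡⟨ cong to (sym (digit s i)) ⟩
    to (finToFun (toBinary s) i)  ≡⟨ cong (λ z → to (finToFun z i)) eq ⟩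
    to (finToFun (toBinary t) i)  ≡⟨ cong to (digit t i) ⟩
    to (from (lookup t i))        ≡⟨ strictlyInverseˡ (lookup t i) ⟩
    lookup t i                    ∎

-- Pigeonhole for subsets: m pairwise distinct nonempty subsets of [j] satisfy
-- m < 2^j, since together with ⊥ they are m + 1 distinct subsets.
distinct-nonempty-bound : ∀ {m j} (f : Fin m → Subset j) →
  Injective _≡_ _≡_ f → (∀ x → Nonempty (f x)) → m < 2 ^ j
distinct-nonempty-bound {m} {j} f f-injective nonempty =
  injective⇒≤ (withEmpty-injective ∘ toBinary-injective)
  where
  withEmpty : Fin (suc m) → Subset j
  withEmpty Fin.zero    = ⊥
  withEmpty (Fin.suc x) = f x
  ≢⊥ : ∀ x → f x ≢ ⊥
  ≢⊥ x fx≡⊥ = let (i , i∈) = nonempty x in ∉⊥ (subst (i ∈_) fx≡⊥ i∈)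
  withEmpty-injective : Injective _≡_ _≡_ withEmpty
  withEmpty-injective {Fin.zero}  {Fin.zero}  _  = refl
  withEmpty-injective {Fin.zero}  {Fin.suc y} eq = contradiction (sym eq) (≢⊥ y)
  withEmpty-injective {Fin.suc x} {Fin.zero}  eq = contradiction eq (≢⊥ x)
  withEmpty-injective {Fin.suc x} {Fin.suc y} eq = cong Fin.suc (f-injective eq)

strongRoyal-order-bound : ∀ {n j} (G : Graph n) → NoIsolatedVertex G →
  HasStrongRoyal G j → n < 2 ^ j
strongRoyal-order-bound G noIsolated (c , royal) =
  distinct-nonempty-bound (induced c) royal
    (λ v → let (u , vu) = noIsolated v in induced-nonempty c v u vu)

-- A connected graph with at least two vertices has no isolated vertex: the first
-- step of a walk from a to another vertex is an edge at a.
connected⇒noIsolated : ∀ {n} (G : Graph n) → 2 ≤ n → Connected G → NoIsolatedVertex G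
connected⇒noIsolated {suc (suc _)} G (s≤s (s≤s _)) conn a = firstStep (conn a (other a)) (other≢ a)
  where
  other : Fin _ → Fin _
  other Fin.zero    = Fin.suc Fin.zero
  other (Fin.suc _) = Fin.zero
  other≢ : ∀ a → a ≢ other a
  other≢ Fin.zero    ()
  other≢ (Fin.suc _) ()
  firstStep : ∀ {a b} → Walk G a b → a ≢ b → ∃[ u ] T (Adj G a u)
  firstStep here        a≢a = contradiction refl a≢a
  firstStep (step au _) _   = _ , au

layer : ∀ {n} → Fin n ⊎ Fin n → Bool
layer (inj₁ _) = false
layer (inj₂ _) = true

base : ∀ {n} → Fin n ⊎ Fin n → Fin n
base (inj₁ a) = a
base (inj₂ a) = a

layer-base-injective : ∀ {n} (p q : Fin n ⊎ Fin n) → layer p ≡ layer q → base p ≡ base q → p ≡ q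
layer-base-injective (inj₁ a) (inj₁ .a) _ refl = refl
layer-base-injective (inj₂ a) (inj₂ .a) _ refl = refl

rung : ∀ {n} → Fin n ⊎ Fin n → Fin n ⊎ Fin n
rung (inj₁ a) = inj₂ a
rung (inj₂ a) = inj₁ a

rung-adjacent : ∀ {n} {G : Graph n} p → T (□K₂-adj G p (rung p))
rung-adjacent (inj₁ a) = fromWitness refl
rung-adjacent (inj₂ a) = fromWitness refl

module Prism {n} (G : Graph n) where

  adjacent-join : ∀ p q → T (□K₂-adj G p q) → T (Adj (G □K₂) (join n n p) (join n n q))
  adjacent-join p q = subst₂ (λ p′ q′ → T (□K₂-adj G p′ q′)) (sym (splitAt-join n n p)) (sym (splitAt-join n n q))

  noIsolated-□ : NoIsolatedVertex (G □K₂)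
  noIsolated-□ x = join n n (rung (splitAt n x)) ,
    subst (λ y → T (Adj (G □K₂) y (join n n (rung (splitAt n x))))) (join-splitAt n n x)
      (adjacent-join (splitAt n x) (rung (splitAt n x)) (rung-adjacent (splitAt n x)))

  -- Each layer is a copy of G, so walks lift; rungs connect the layers.
  connected-□ : Connected G → Connected (G □K₂)
  connected-□ conn x y =
    subst₂ (Walk (G □K₂)) (join-splitAt n n x) (join-splitAt n n y) (walk (splitAt n x) (splitAt n y))
    where
    inLayer : Bool → Fin n → Fin n ⊎ Fin n
    inLayer false = inj₁
    inLayer true  = inj₂
    liftWalk : ∀ b {a a′} → Walk G a a′ → Walk (G □K₂) (join n n (inLayer b a)) (join n n (inLayer b a′))
    liftWalk b     here        = here
    liftWalk false (step au w) = step (adjacent-join (inj₁ _) (inj₁ _) au) (liftWalk false w)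
    liftWalk true  (step au w) = step (adjacent-join (inj₂ _) (inj₂ _) au) (liftWalk true w)
    walk : ∀ p q → Walk (G □K₂) (join n n p) (join n n q)
    walk (inj₁ a) (inj₁ b) = liftWalk false (conn a b)
    walk (inj₂ a) (inj₂ b) = liftWalk true (conn a b)
    walk (inj₁ a) (inj₂ b) = step (adjacent-join (inj₁ a) (inj₂ a) (fromWitness refl)) (liftWalk true (conn a b))
    walk (inj₂ a) (inj₁ b) = step (adjacent-join (inj₂ a) (inj₁ a) (fromWitness refl)) (liftWalk false (conn a b))

  -- The extended colouring of G □ K₂ built from a colouring c of G (see the
  -- header); colour 0 marks exactly the edges of the second layer.
  module Extension {k} (c : EdgeColouring G k) (noIsolated : NoIsolatedVertex G) where

    colour : Fin n ⊎ Fin n → Fin n ⊎ Fin n → Subset (suc k)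
    colour (inj₁ a) (inj₁ b) = false ∷ col c a b
    colour (inj₂ a) (inj₂ b) = true ∷ col c a b
    colour (inj₁ a) (inj₂ b) = false ∷ induced c a
    colour (inj₂ a) (inj₁ b) = false ∷ induced c b

    colour-sym : ∀ p q → T (□K₂-adj G p q) → colour p q ≡ colour q p
    colour-sym (inj₁ a) (inj₁ b) ab = cong (false ∷_) (col-sym c a b ab)
    colour-sym (inj₂ a) (inj₂ b) ab = cong (true ∷_) (col-sym c a b ab)
    colour-sym (inj₁ a) (inj₂ b) _  = refl
    colour-sym (inj₂ a) (inj₁ b) _  = refl

    colour-nonempty : ∀ p q → T (□K₂-adj G p q) → Nonempty (colour p q)
    colour-nonempty (inj₁ a) (inj₁ b) ab = let (i , i∈) = col-nonempty c a b ab in Fin.suc i , there i∈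
    colour-nonempty (inj₂ a) (inj₂ b) _  = Fin.zero , here
    colour-nonempty (inj₁ a) (inj₂ b) _  =
      let (u , au) = noIsolated a ; (i , i∈) = induced-nonempty c a u au in Fin.suc i , there i∈
    colour-nonempty (inj₂ a) (inj₁ b) _  =
      let (u , bu) = noIsolated b ; (i , i∈) = induced-nonempty c b u bu in Fin.suc i , there i∈

    ĉ : EdgeColouring (G □K₂) (suc k)
    ĉ = record
      { col          = λ x y → colour (splitAt n x) (splitAt n y)
      ; col-sym      = λ x y → colour-sym (splitAt n x) (splitAt n y)
      ; col-nonempty = λ x y → colour-nonempty (splitAt n x) (splitAt n y)
      }

    ∈-induced-□⁻ : ∀ p {i} → i ∈ induced ĉ (join n n p) → ∃[ q ] (T (□K₂-adj G p q) × i ∈ colour p q)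
    ∈-induced-□⁻ p {i} i∈ =
      let (u , pu , i∈pu) = ∈-induced⁻ ĉ (join n n p) i∈
      in splitAt n u , subst (λ p′ → T (□K₂-adj G p′ (splitAt n u)) × i ∈ colour p′ (splitAt n u))
                              (splitAt-join n n p) (pu , i∈pu)

    ∈-induced-□⁺ : ∀ p q {i} → T (□K₂-adj G p q) → i ∈ colour p q → i ∈ induced ĉ (join n n p)
    ∈-induced-□⁺ p q {i} pq i∈ =
      ∈-induced⁺ ĉ (join n n p) (join n n q) (adjacent-join p q pq)
        (subst₂ (λ p′ q′ → i ∈ colour p′ q′) (sym (splitAt-join n n p)) (sym (splitAt-join n n q)) i∈)

    colour-⊆ : ∀ p q → T (□K₂-adj G p q) → colour p q ⊆ (layer p ∷ induced c (base p))
    colour-⊆ (inj₁ a) (inj₁ b) ab = s⊆s (∈-induced⁺ c a b ab)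
    colour-⊆ (inj₂ a) (inj₂ b) ab = s⊆s (∈-induced⁺ c a b ab)
    colour-⊆ (inj₁ a) (inj₂ b) _  = λ i∈ → i∈
    colour-⊆ (inj₂ a) (inj₁ b) ab with toWitness ab
    ... | refl = λ { (there i∈) → there i∈ }

    -- Conversely, layer p ∷ c'(base p) is covered: 0 by a second-layer edge,
    -- the old colours by the rung.
    ⊆-induced-□ : ∀ p → (layer p ∷ induced c (base p)) ⊆ induced ĉ (join n n p)
    ⊆-induced-□ (inj₂ a) here = let (b , ab) = noIsolated a in ∈-induced-□⁺ (inj₂ a) (inj₂ b) ab here
    ⊆-induced-□ p (there i∈) = ∈-induced-□⁺ p (rung p) (rung-adjacent p) (rungColour p (there i∈))
      where
      rungColour : ∀ p → (false ∷ induced c (base p)) ⊆ colour p (rung p)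
      rungColour (inj₁ _) i∈ = i∈
      rungColour (inj₂ _) i∈ = i∈

    induced-□ : ∀ p → induced ĉ (join n n p) ≡ layer p ∷ induced c (base p)
    induced-□ p = ⊆-antisym
      (λ i∈ → let (q , pq , i∈pq) = ∈-induced-□⁻ p i∈ in colour-⊆ p q pq i∈pq)
      (⊆-induced-□ p)

    strongRoyal-□ : IsStrongRoyal c → IsStrongRoyal ĉ
    strongRoyal-□ royal {x} {y} eq = begin
      x                      ≡⟨ sym (join-splitAt n n x) ⟩
      join n n (splitAt n x) ≡⟨ cong (join n n) (layer-base-injective p q sameLayer (royal sameInduced)) ⟩
      join n n (splitAt n y) ≡⟨ join-splitAt n n y ⟩
      y                      ∎
      where
      open ≡-Reasoning
      p = splitAt n x
      q = splitAt n y
      inducedAt : ∀ z → induced ĉ z ≡ layer (splitAt n z) ∷ induced c (base (splitAt n z))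
      inducedAt z = trans (cong (induced ĉ) (sym (join-splitAt n n z))) (induced-□ (splitAt n z))
      sameLayer : layer p ≡ layer q
      sameLayer = proj₁ (∷-injective (trans (sym (inducedAt x)) (trans eq (inducedAt y))))
      sameInduced : induced c (base p) ≡ induced c (base q)
      sameInduced = proj₂ (∷-injective (trans (sym (inducedAt x)) (trans eq (inducedAt y))))

  strongRoyal-extend : ∀ {k} → NoIsolatedVertex G → HasStrongRoyal G k → HasStrongRoyal (G □K₂) (suc k)
  strongRoyal-extend noIsolated (c , royal) = Extension.ĉ c noIsolated , Extension.strongRoyal-□ c noIsolated royal

2^suc : ∀ k → 2 ^ suc k ≡ 2 ^ k + 2 ^ k
2^suc k = cong (2 ^ k +_) (+-identityʳ (2 ^ k))

2^-reflect-< : ∀ {a b} → 2 ^ a < 2 ^ b → a < b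
2^-reflect-< {a} {b} 2^a<2^b with a <? b
... | yes a<b = a<b
... | no  a≮b = contradiction (^-monoʳ-≤ 2 (≮⇒≥ a≮b)) (<⇒≱ 2^a<2^b)

proposition2p4 : ∀ {n : ℕ} (G : Graph n) → Connected G → 4 ≤ n →
    (∀ k k' → IsSroy G k → IsSroy (G □K₂) k' → k' ≤ suc k)
    × (RoyalZero G → RoyalZero (G □K₂))
proposition2p4 {n} G conn 4≤n = sroy-□ , royalZero-□
  where
  open Prism G
  noIsolated : NoIsolatedVertex G
  noIsolated = connected⇒noIsolated G (≤-trans (m≤m+n 2 2) 4≤n) conn

  sroy-□ : ∀ k k' → IsSroy G k → IsSroy (G □K₂) k' → k' ≤ suc k
  sroy-□ k k' (hasG , _) (_ , minimalH) = minimalH (suc k) (strongRoyal-extend noIsolated hasG)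

  -- With 2^(k-1) ≤ n < 2^k (so k ≥ 1), G □ K₂ has order in [2^k, 2^(k+1)) and
  -- sroy(G □ K₂) = k + 1: ≤ by the extension, ≥ by the counting bound.
  royalZero-□ : RoyalZero G → RoyalZero (G □K₂)
  royalZero-□ (_ , _ , zero , _ , n<1 , _) with ≤-<-trans 4≤n n<1
  ... | s≤s ()
  royalZero-□ (_ , 3≤n , suc k , lo , hi , (hasG , _)) =
    connected-□ conn , ≤-trans 3≤n (m≤m+n n n) , suc (suc k) , lo′ , hi′ ,
    strongRoyal-extend noIsolated hasG ,
    λ j hasH → 2^-reflect-< (≤-<-trans lo′ (strongRoyal-order-bound (G □K₂) noIsolated-□ hasH))
    where
    lo′ : 2 ^ suc k ≤ n + n
    lo′ = subst (_≤ n + n) (sym (2^suc k)) (+-mono-≤ lo lo)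
    hi′ : n + n < 2 ^ suc (suc k)
    hi′ = subst (n + n <_) (sym (2^suc (suc k))) (+-mono-< hi hi)
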